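{- Let $\mathbf{u}$ be a recurrent infinite word over the alphabet $\{0,1,\dots,m-1\}$, let $n\in\mathbb{N}$, and let $B\ge n$ be an integer such that the prefix $\mathbf{u}_{[B]}$ contains every factor of $\mathbf{u}$ of length $n$ and both begins and ends with $\mathbf{u}_{[n]}$. Let $\mathcal{Z}$ be any abelian co-decomposition of the ordered pair $\binom{\mathbf{u}_{[B]}\mathbf{u}_{[n]}^{ -1}}{\mathbf{u}_{[n]}^{ -1}\mathbf{u}_{[B]}}$. Then $$\mathcal{P}^{\mathrm{rel}}_{\mathbf{u}}(n)=\bigcup_{\binom{z}{\tilde z}\in\mathcal{Z}}\{\Psi(s)-\Psi(r)\ :\ r\text{ a prefix of }z,\ s\text{ a prefix of }\tilde z,\ |s|=|r|\}.$$
   Context: An infinite word is recurrent if each of its factors occurs infinitely often. $\mathbf{u}_{[n]}$ is the prefix of $\mathbf{u}$ of length $n$; for finite words, $x^{ -1}(xv)=v$ and $(vx)x^{ -1}=v$. $\Psi(w)=(|w|_0,\dots,|w|_{m-1})$ is the Parikh vector of a finite word $w$ ($|w|_\ell$ = number of occurrences of $\ell$). Prefixes include the empty word. The relative Parikh vector of a factor $w$ of $\mathbf{u}$ of length $n$ is $\Psi(w)-\Psi(\mathbf{u}_{[n]})$, and $\mathcal{P}^{\mathrm{rel}}_{\mathbf{u}}(n)$ is the set of relative Parikh vectors of all factors of $\mathbf{u}$ of length $n$. Abelian co-decomposition: if $v,w$ are finite words with $\Psi(v)=\Psi(w)$, and $v=z_0z_1\cdots z_h$, $w=\tilde z_0\tilde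 z_1\cdots\tilde z_h$ with all $z_j,\tilde z_j$ nonempty and $\Psi(z_j)=\Psi(\tilde z_j)$ for every $j$, then the set of ordered pairs $\{\binom{z_0}{\tilde z_0},\dots,\binom{z_h}{\tilde z_h}\}$ is called an abelian co-decomposition of $\binom{v}{w}$ (it is generally not unique). Note $\Psi(\mathbf{u}_{[B]}\mathbf{u}_{[n]}^{ -1})=\Psi(\mathbf{u}_{[n]}^{ -1}\mathbf{u}_{[B]})$. -}

module Defs where

open import Data.Nat using (ℕ; zero; suc; _+_; _∸_; _≤_; _≥_)
open import Data.Integer as ℤ using (ℤ; +_)
open import Data.Fin using (Fin)
open import Data.Fin.Properties using (_≟_)
open import Data.List using (List; []; _∷_; _++_; length; filter; concat; map; take; drop)
open import Data.List.Membership.Propositional using (_∈_)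
open import Data.Vec using (Vec; tabulate; zipWith)
open import Data.Product using (Σ; ∃; ∃-syntax; _×_; _,_; proj₁; proj₂)
open import Relation.Binary.PropositionalEquality using (_≡_; _≢_)
open import Function.Bundles using (_⇔_)

InfWord : ℕ → Set
InfWord m = ℕ → Fin m

Word : ℕ → Set
Word m = List (Fin m)

factor : ∀ {m} → InfWord m → ℕ → ℕ → Word m
factor u i zero = []
factor u i (suc len) = u i ∷ factor u (suc i) len

pref : ∀ {m} → InfWord m → ℕ → Word m
pref u n = factor u 0 n

Recurrent : ∀ {m} → InfWord m → Set
Recurrent u = ∀ i len N → ∃[ j ] (j ≥ N × factor u j len ≡ factor u i len)

count : ∀ {m} → Fin m → Word m → ℕ
count ℓ w = length (filter (_≟ ℓ) w)

Ψ : ∀ {m} → Word m → Vec ℕ m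
Ψ w = tabulate (λ ℓ → count ℓ w)

_⊝_ : ∀ {m} → Vec ℕ m → Vec ℕ m → Vec ℤ m
a ⊝ b = zipWith (λ x y → (+ x) ℤ.- (+ y)) a b

InPrel : ∀ {m} → InfWord m → ℕ → Vec ℤ m → Set
InPrel u n x = ∃[ i ] (x ≡ Ψ (factor u i n) ⊝ Ψ (pref u n))

IsPrefix : ∀ {m} → Word m → Word m → Set
IsPrefix r z = ∃[ t ] (r ++ t ≡ z)

record CoDecomposition {m} (v w : Word m) : Set where
  field
    pairs      : List (Word m × Word m)
    atLeastOne : pairs ≢ []
    parikhEq   : Ψ v ≡ Ψ w
    nonempty   : ∀ {p} → p ∈ pairs → (proj₁ p ≢ []) × (proj₂ p ≢ [])
    pairParikh : ∀ {p} → p ∈ pairs → Ψ (proj₁ p) ≡ Ψ (proj₂ p)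
    concatTop  : concat (map proj₁ pairs) ≡ v
    concatBot  : concat (map proj₂ pairs) ≡ w

InUnion : ∀ {m} → List (Word m × Word m) → Vec ℤ m → Set
InUnion {m} Z x =
  ∃[ p ] (p ∈ Z × ∃[ r ] ∃[ s ]
    (IsPrefix r (proj₁ p) × IsPrefix s (proj₂ p) × length s ≡ length r × x ≡ Ψ s ⊝ Ψ r))

-- Write v = u_[B] u_[n]⁻¹ and w = u_[n]⁻¹ u_[B], so v = u[0,B-n) and
-- w = u[n,B), and let  prefixDiff v w j = Ψ(w_[j]) - Ψ(v_[j]).  The proof
-- compares both sides of the proposition with the set
--   { prefixDiff v w j : j ≤ |v| }.
--
-- (1) Window lemma.  Since u[0,j) u[j,j+n) = u[0,n) u[n,n+j) = u[0,j+n),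
--     the relative Parikh vector of the factor at position j equals
--     Ψ(u[n,n+j)) - Ψ(u[0,j)), which is prefixDiff v w j when j ≤ B - n.
--     Because u_[B] contains every factor of length n at a position
--     j ≤ B - n, the relative Parikh vectors are exactly these values.
-- (2) Co-decomposition lemma.  If v = z₀⋯z_h and w = z̃₀⋯z̃_h with
--     Ψ(z_k) = Ψ(z̃_k), then inside a block the prefix difference is a
--     difference of equal-length prefixes of z_k and z̃_k, and crossing a
--     whole block does not change it (the block's letters cancel).  Hence
--     the values prefixDiff v w j are exactly the union over the blocks.
-- The file first collects facts on Parikh vectors and lists, then proves
-- (2) for arbitrary lists of balanced pairs, then (1), and composes them.

module Submission where

open import Defs
open import Data.Nat using (ℕ; _+_; _∸_; _≤_; _≥_)
open import Data.Integer using (ℤ)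
open import Data.Vec using (Vec)
open import Data.List using (take; drop)
open import Data.Product using (∃-syntax; _×_)
open import Relation.Binary.PropositionalEquality using (_≡_)
open import Function.Bundles using (_⇔_)

open import Data.Nat using (zero; suc; s≤s; _≤?_)
open import Data.Nat.Properties
  using (+-comm; +-suc; +-identityʳ; ≤-refl; ≤-trans; ≰⇒≥;
         +-monoʳ-≤; m∸n≤m; m+n≤o⇒m≤o∸n; m≤n+o⇒m∸n≤o; m+[n∸m]≡n; m≤n⇒m⊓n≡m;
         +-0-commutativeMonoid)
open import Data.Nat.Tactic.RingSolver using (solve-∀)
open import Data.Integer as ℤ using (_⊖_)
open import Data.Integer.Properties using ([+m]-[+n]≡m⊖n; +-cancelˡ-⊖)
open import Data.Fin using (Fin) renaming (zero to fzero; suc to fsuc)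
open import Data.Fin.Properties using (_≟_)
open import Data.List using (List; []; _∷_; _++_; [_]; length; filter; concat; map)
open import Data.List.Properties using (filter-++; length-++; length-++-≤ˡ; ++-assoc; ++-identityʳ; take++drop≡id; take-all; length-take)
open import Data.List.Relation.Unary.All as All using (All; []; _∷_)
open import Data.List.Relation.Unary.Any using (here; there)
import Data.Vec as Vec
open import Data.Vec.Properties using (lookup∘tabulate; tabulate-cong)
open import Data.Product using (_,_; proj₁; proj₂)
open import Data.Empty using (⊥-elim)
open import Relation.Binary.PropositionalEquality
  using (refl; sym; trans; cong; cong₂; subst; subst₂; _≢_; module ≡-Reasoning)
open import Relation.Nullary using (yes; no)
open import Function.Base using (_∘_)
open import Function.Bundles using (mk⇔)
import Function.Properties.Equivalence as ⇔
open import Algebra.Properties.CommutativeMonoid.Sum +-0-commutativeMonoid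
  using (sum-cong-≗; sum-replicate-zero; ∑-distrib-+; sum-syntax)

private
  variable
    m : ℕ

ℤ-cross : ∀ a b c d → a + d ≡ c + b → ℤ.+ a ℤ.- ℤ.+ b ≡ ℤ.+ c ℤ.- ℤ.+ d
ℤ-cross a b c d a+d≡c+b = begin
  ℤ.+ a ℤ.- ℤ.+ b      ≡⟨ [+m]-[+n]≡m⊖n a b ⟩
  a ⊖ b                ≡⟨ +-cancelˡ-⊖ d a b ⟨
  (d + a) ⊖ (d + b)    ≡⟨ cong₂ _⊖_ (trans (+-comm d a) (trans a+d≡c+b (+-comm c b))) (+-comm d b) ⟩
  (b + c) ⊖ (b + d)    ≡⟨ +-cancelˡ-⊖ b c d ⟩
  c ⊖ d                ≡⟨ [+m]-[+n]≡m⊖n c d ⟨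
  ℤ.+ c ℤ.- ℤ.+ d      ∎
  where open ≡-Reasoning

zipWith-tabulate : ∀ {A B C : Set} {k} (f : A → B → C) (g : Fin k → A) (h : Fin k → B) →
  Vec.zipWith f (Vec.tabulate g) (Vec.tabulate h) ≡ Vec.tabulate (λ i → f (g i) (h i))
zipWith-tabulate {k = zero}  f g h = refl
zipWith-tabulate {k = suc k} f g h = cong (_ Vec.∷_) (zipWith-tabulate f (g ∘ fsuc) (h ∘ fsuc))

Ψ-cross : {a b c d : Word m} → (∀ ℓ → count ℓ a + count ℓ d ≡ count ℓ c + count ℓ b) →
  Ψ a ⊝ Ψ b ≡ Ψ c ⊝ Ψ d
Ψ-cross {a = a} {b} {c} {d} counts = begin
  Ψ a ⊝ Ψ b                                                 ≡⟨ zipWith-tabulate _ _ _ ⟩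
  Vec.tabulate (λ ℓ → ℤ.+ count ℓ a ℤ.- ℤ.+ count ℓ b)      ≡⟨ tabulate-cong letterwise ⟩
  Vec.tabulate (λ ℓ → ℤ.+ count ℓ c ℤ.- ℤ.+ count ℓ d)      ≡⟨ zipWith-tabulate _ _ _ ⟨
  Ψ c ⊝ Ψ d                                                 ∎
  where
  open ≡-Reasoning
  letterwise : ∀ ℓ → ℤ.+ count ℓ a ℤ.- ℤ.+ count ℓ b ≡ ℤ.+ count ℓ c ℤ.- ℤ.+ count ℓ d
  letterwise ℓ = ℤ-cross (count ℓ a) (count ℓ b) (count ℓ c) (count ℓ d) (counts ℓ)

count-Ψ : {a b : Word m} → Ψ a ≡ Ψ b → ∀ ℓ → count ℓ a ≡ count ℓ b
count-Ψ {a = a} {b} Ψa≡Ψb ℓ =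
  trans (sym (lookup∘tabulate _ ℓ)) (trans (cong (λ v → Vec.lookup v ℓ) Ψa≡Ψb) (lookup∘tabulate _ ℓ))

count-++ : (ℓ : Fin m) (a b : Word m) → count ℓ (a ++ b) ≡ count ℓ a + count ℓ b
count-++ ℓ a b = trans (cong length (filter-++ (_≟ ℓ) a b)) (length-++ (filter (_≟ ℓ) a))

∑-count-letter : (x : Fin m) → ∑[ ℓ < m ] count ℓ [ x ] ≡ 1
∑-count-letter {suc m} fzero    = cong suc (trans (sum-cong-≗ {m} (λ _ → refl)) (sum-replicate-zero m))
∑-count-letter {suc m} (fsuc x) = trans (sum-cong-≗ {m} count-fsuc) (∑-count-letter x)
  where
  count-fsuc : ∀ ℓ → count (fsuc ℓ) [ fsuc x ] ≡ count ℓ [ x ]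
  count-fsuc ℓ with x ≟ ℓ
  ... | yes _ = refl
  ... | no _  = refl

length-∑-count : (w : Word m) → length w ≡ ∑[ ℓ < m ] count ℓ w
length-∑-count {m} []      = sym (trans (sum-cong-≗ {m} (λ _ → refl)) (sum-replicate-zero m))
length-∑-count {m} (x ∷ w) = sym (begin
  ∑[ ℓ < m ] count ℓ (x ∷ w)                          ≡⟨ sum-cong-≗ {m} (λ ℓ → count-++ ℓ [ x ] w) ⟩
  ∑[ ℓ < m ] (count ℓ [ x ] + count ℓ w)              ≡⟨ ∑-distrib-+ (λ ℓ → count ℓ [ x ]) (λ ℓ → count ℓ w) ⟩
  ∑[ ℓ < m ] count ℓ [ x ] + ∑[ ℓ < m ] count ℓ w     ≡⟨ cong₂ _+_ (∑-count-letter x) (sym (length-∑-count w)) ⟩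
  suc (length w)                                      ∎)
  where open ≡-Reasoning

Ψ-length : {a b : Word m} → Ψ a ≡ Ψ b → length a ≡ length b
Ψ-length {a = a} {b} Ψa≡Ψb =
  trans (length-∑-count a) (trans (sum-cong-≗ (count-Ψ {a = a} {b} Ψa≡Ψb)) (sym (length-∑-count b)))

⊝-cancel : {z z̃ r s : Word m} → Ψ z ≡ Ψ z̃ → Ψ (z̃ ++ s) ⊝ Ψ (z ++ r) ≡ Ψ s ⊝ Ψ r
⊝-cancel {z = z} {z̃} {r} {s} Ψz≡Ψz̃ = Ψ-cross {a = z̃ ++ s} {z ++ r} {s} {r} λ ℓ → begin
  count ℓ (z̃ ++ s) + count ℓ r              ≡⟨ cong (_+ count ℓ r) (count-++ ℓ z̃ s) ⟩
  count ℓ z̃ + count ℓ s + count ℓ r         ≡⟨ cong (λ k → k + count ℓ s + count ℓ r) (count-Ψ {a = z} {z̃} Ψz≡Ψz̃ ℓ) ⟨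
  count ℓ z + count ℓ s + count ℓ r          ≡⟨ rearrange (count ℓ z) (count ℓ s) (count ℓ r) ⟩
  count ℓ s + (count ℓ z + count ℓ r)        ≡⟨ cong (count ℓ s +_) (count-++ ℓ z r) ⟨
  count ℓ s + count ℓ (z ++ r)               ∎
  where
  open ≡-Reasoning
  rearrange : ∀ a b c → a + b + c ≡ b + (a + c)
  rearrange = solve-∀

take-++ˡ : ∀ {A : Set} (xs ys : List A) {j} → j ≤ length xs → take j (xs ++ ys) ≡ take j xs
take-++ˡ xs       ys {zero}  _         = refl
take-++ˡ (x ∷ xs) ys {suc j} (s≤s j≤) = cong (x ∷_) (take-++ˡ xs ys j≤)

take-++ʳ : ∀ {A : Set} (xs ys : List A) k → take (length xs + k) (xs ++ ys) ≡ xs ++ take k ys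
take-++ʳ []       ys k = refl
take-++ʳ (x ∷ xs) ys k = cong (x ∷_) (take-++ʳ xs ys k)

length-take-≤ : ∀ {A : Set} (xs : List A) {j} → j ≤ length xs → length (take j xs) ≡ j
length-take-≤ xs {j} j≤ = trans (length-take j xs) (m≤n⇒m⊓n≡m j≤)

take-prefix : ∀ {A : Set} (r t ys : List A) → take (length r) ((r ++ t) ++ ys) ≡ r
take-prefix r t ys = trans (cong (take (length r)) (++-assoc r t ys)) (trans
  (take-++ˡ r (t ++ ys) ≤-refl) (take-all (length r) r ≤-refl))

prefixDiff : Word m → Word m → ℕ → Vec ℤ m
prefixDiff v w j = Ψ (take j w) ⊝ Ψ (take j v)

PrefixDiffs : Word m → Word m → Vec ℤ m → Set
PrefixDiffs v w x = ∃[ j ] (j ≤ length v × x ≡ prefixDiff v w j)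

InPair : Word m × Word m → Vec ℤ m → Set
InPair p x = ∃[ r ] ∃[ s ]
  (IsPrefix r (proj₁ p) × IsPrefix s (proj₂ p) × length s ≡ length r × x ≡ Ψ s ⊝ Ψ r)

Balanced : Word m × Word m → Set
Balanced p = Ψ (proj₁ p) ≡ Ψ (proj₂ p)

concat₁ concat₂ : List (Word m × Word m) → Word m
concat₁ Z = concat (map proj₁ Z)
concat₂ Z = concat (map proj₂ Z)

-- Within a balanced leading block (z, z̃) the two words have the same length,
-- which lets prefix positions be transported between z and z̃.
module _ (z z̃ : Word m) (Ψz≡Ψz̃ : Balanced (z , z̃)) {t t̃ : Word m} where

  private
    |z|≡|z̃| : length z ≡ length z̃
    |z|≡|z̃| = Ψ-length {a = z} {z̃} Ψz≡Ψz̃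

  prefixDiff-inPair : ∀ {j} → j ≤ length z → InPair (z , z̃) (prefixDiff (z ++ t) (z̃ ++ t̃) j)
  prefixDiff-inPair {j} j≤z =
    take j z , take j z̃ , (drop j z , take++drop≡id j z) , (drop j z̃ , take++drop≡id j z̃) ,
    trans (length-take-≤ z̃ j≤z̃) (sym (length-take-≤ z j≤z)) ,
    cong₂ (λ a b → Ψ a ⊝ Ψ b) (take-++ˡ z̃ t̃ j≤z̃) (take-++ˡ z t j≤z)
    where
    j≤z̃ : j ≤ length z̃
    j≤z̃ = subst (j ≤_) |z|≡|z̃| j≤z

  prefixDiff-skip : ∀ k → prefixDiff (z ++ t) (z̃ ++ t̃) (length z + k) ≡ prefixDiff t t̃ k
  prefixDiff-skip k = begin
    Ψ (take (length z + k) (z̃ ++ t̃)) ⊝ Ψ (take (length z + k) (z ++ t))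
      ≡⟨ cong₂ (λ a b → Ψ a ⊝ Ψ b) z̃-part (take-++ʳ z t k) ⟩
    Ψ (z̃ ++ take k t̃) ⊝ Ψ (z ++ take k t)
      ≡⟨ ⊝-cancel {z = z} {z̃} Ψz≡Ψz̃ ⟩
    Ψ (take k t̃) ⊝ Ψ (take k t)
      ∎
    where
    open ≡-Reasoning
    z̃-part : take (length z + k) (z̃ ++ t̃) ≡ z̃ ++ take k t̃
    z̃-part = trans (cong (λ l → take (l + k) (z̃ ++ t̃)) |z|≡|z̃|) (take-++ʳ z̃ t̃ k)

inPair-prefixDiff : (z z̃ : Word m) {t t̃ : Word m} {x : Vec ℤ m} → InPair (z , z̃) x →
  ∃[ j ] (j ≤ length z × x ≡ prefixDiff (z ++ t) (z̃ ++ t̃) j)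
inPair-prefixDiff _ _ {t} {t̃} (r , s , (ρ , refl) , (σ , refl) , |s|≡|r| , refl) =
    length r , length-++-≤ˡ r ,
    sym (cong₂ (λ a b → Ψ a ⊝ Ψ b) (trans (cong (λ l → take l ((s ++ σ) ++ t̃)) (sym |s|≡|r|)) (take-prefix s σ t̃))
                   (take-prefix r ρ t))

union→prefixDiffs : (Z : List (Word m × Word m)) → All Balanced Z →
  ∀ {x} → InUnion Z x → PrefixDiffs (concat₁ Z) (concat₂ Z) x
union→prefixDiffs ((z , z̃) ∷ Z) (bal ∷ bals) (_ , here refl , inPair)
  with j , j≤z , x≡ ← inPair-prefixDiff z z̃ {concat₁ Z} {concat₂ Z} inPair =
  j , ≤-trans j≤z (length-++-≤ˡ z) , x≡
union→prefixDiffs ((z , z̃) ∷ Z) (bal ∷ bals) (p , there p∈Z , inPair)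
  with k , k≤ , x≡ ← union→prefixDiffs Z bals (p , p∈Z , inPair) =
  length z + k , subst (length z + k ≤_) (sym (length-++ z)) (+-monoʳ-≤ (length z) k≤) ,
  trans x≡ (sym (prefixDiff-skip z z̃ bal k))

prefixDiffs→union : (Z : List (Word m × Word m)) → Z ≢ [] → All Balanced Z →
  ∀ {x} → PrefixDiffs (concat₁ Z) (concat₂ Z) x → InUnion Z x
prefixDiffs→union [] Z≢[] _ _ = ⊥-elim (Z≢[] refl)
prefixDiffs→union ((z , z̃) ∷ Z) _ (bal ∷ bals) (j , j≤ , refl) with j ≤? length z
... | yes j≤z = (z , z̃) , here refl , prefixDiff-inPair z z̃ bal j≤z
prefixDiffs→union ((z , z̃) ∷ []) _ _ (j , j≤ , refl) | no j≰z =
  ⊥-elim (j≰z (subst (j ≤_) (cong length (++-identityʳ z)) j≤))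
prefixDiffs→union ((z , z̃) ∷ Z@(_ ∷ _)) _ (bal ∷ bals) (j , j≤ , refl) | no j≰z =
  subst (InUnion ((z , z̃) ∷ Z)) (sym shift) (union-there (prefixDiffs→union Z (λ ()) bals (k , k≤ , refl)))
  where
  k : ℕ
  k = j ∸ length z
  k≤ : k ≤ length (concat₁ Z)
  k≤ = m≤n+o⇒m∸n≤o j (length z) (subst (j ≤_) (length-++ z) j≤)
  shift : prefixDiff (z ++ concat₁ Z) (z̃ ++ concat₂ Z) j ≡ prefixDiff (concat₁ Z) (concat₂ Z) k
  shift = trans (cong (prefixDiff (z ++ concat₁ Z) (z̃ ++ concat₂ Z)) (sym (m+[n∸m]≡n (≰⇒≥ j≰z))))
                (prefixDiff-skip z z̃ bal k)
  union-there : ∀ {q x} → InUnion Z x → InUnion (q ∷ Z) x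
  union-there (p , p∈Z , inPair) = p , there p∈Z , inPair

coDecomposition-union : {v w : Word m} (Z : CoDecomposition v w) (x : Vec ℤ m) →
  InUnion (CoDecomposition.pairs Z) x ⇔ PrefixDiffs v w x
coDecomposition-union Z x =
  subst₂ (λ v w → InUnion pairs x ⇔ PrefixDiffs v w x) concatTop concatBot
    (mk⇔ (union→prefixDiffs pairs balanced) (prefixDiffs→union pairs atLeastOne balanced))
  where
  open CoDecomposition Z
  balanced : All Balanced pairs
  balanced = All.tabulate pairParikh

factor-++ : (u : InfWord m) (i a b : ℕ) → factor u i (a + b) ≡ factor u i a ++ factor u (i + a) b
factor-++ u i zero    b = cong (λ k → factor u k b) (sym (+-identityʳ i))
factor-++ u i (suc a) b = cong (u i ∷_) (trans (factor-++ u (suc i) a b)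
  (cong (λ k → factor u (suc i) a ++ factor u k b) (sym (+-suc i a))))

take-factor : (u : InfWord m) (i : ℕ) {k L : ℕ} → k ≤ L → take k (factor u i L) ≡ factor u i k
take-factor u i {zero}  _         = refl
take-factor u i {suc k} (s≤s k≤L) = cong (u i ∷_) (take-factor u (suc i) k≤L)

drop-factor : (u : InfWord m) (i k L : ℕ) → drop k (factor u i L) ≡ factor u (i + k) (L ∸ k)
drop-factor u i zero    L       = cong (λ j → factor u j L) (sym (+-identityʳ i))
drop-factor u i (suc k) zero    = refl
drop-factor u i (suc k) (suc L) =
  trans (drop-factor u (suc i) k L) (cong (λ j → factor u j (L ∸ k)) (sym (+-suc i k)))

length-factor : (u : InfWord m) (i L : ℕ) → length (factor u i L) ≡ L
length-factor u i zero    = refl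
length-factor u i (suc L) = cong suc (length-factor u (suc i) L)

-- The window lemma: u[0,j) u[j,j+n) = u[0,n) u[n,n+j), hence the relative
-- Parikh vector of the factor at position j is Ψ(u[n,n+j)) - Ψ(u_[j]).
relParikh-shift : (u : InfWord m) (j n : ℕ) →
  Ψ (factor u j n) ⊝ Ψ (pref u n) ≡ Ψ (factor u n j) ⊝ Ψ (pref u j)
relParikh-shift u j n = Ψ-cross {a = factor u j n} {pref u n} {factor u n j} {pref u j} λ ℓ → begin
  count ℓ (factor u j n) + count ℓ (pref u j)    ≡⟨ +-comm (count ℓ (factor u j n)) _ ⟩
  count ℓ (pref u j) + count ℓ (factor u j n)    ≡⟨ count-++ ℓ (pref u j) (factor u j n) ⟨
  count ℓ (pref u j ++ factor u j n)             ≡⟨ cong (count ℓ) (factor-++ u 0 j n) ⟨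
  count ℓ (pref u (j + n))                       ≡⟨ cong (λ k → count ℓ (pref u k)) (+-comm j n) ⟩
  count ℓ (pref u (n + j))                       ≡⟨ cong (count ℓ) (factor-++ u 0 n j) ⟩
  count ℓ (pref u n ++ factor u n j)             ≡⟨ count-++ ℓ (pref u n) (factor u n j) ⟩
  count ℓ (pref u n) + count ℓ (factor u n j)    ≡⟨ +-comm (count ℓ (pref u n)) _ ⟩
  count ℓ (factor u n j) + count ℓ (pref u n)    ∎
  where open ≡-Reasoning

relParikh-prefixDiff : (u : InfWord m) (n B j : ℕ) → j ≤ B ∸ n →
  Ψ (factor u j n) ⊝ Ψ (pref u n) ≡ prefixDiff (take (B ∸ n) (pref u B)) (drop n (pref u B)) j
relParikh-prefixDiff u n B j j≤ = trans (relParikh-shift u j n) (sym (cong₂ (λ a b → Ψ a ⊝ Ψ b) w[j] v[j]))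
  where
  v[j] : take j (take (B ∸ n) (pref u B)) ≡ pref u j
  v[j] = trans (cong (take j) (take-factor u 0 (m∸n≤m B n))) (take-factor u 0 j≤)
  w[j] : take j (drop n (pref u B)) ≡ factor u n j
  w[j] = trans (cong (take j) (drop-factor u 0 n B)) (take-factor u n j≤)

relParikh⇔prefixDiffs : (u : InfWord m) (n B : ℕ) →
  (∀ i → ∃[ j ] (j + n ≤ B × factor u j n ≡ factor u i n)) → (x : Vec ℤ m) →
  InPrel u n x ⇔ PrefixDiffs (take (B ∸ n) (pref u B)) (drop n (pref u B)) x
relParikh⇔prefixDiffs u n B covers x = mk⇔ to from
  where
  |v| : length (take (B ∸ n) (pref u B)) ≡ B ∸ n
  |v| = trans (cong length (take-factor u 0 (m∸n≤m B n))) (length-factor u 0 (B ∸ n))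
  to : InPrel u n x → PrefixDiffs _ _ x
  to (i , refl) with j , j+n≤B , factor≡ ← covers i =
    j , subst (j ≤_) (sym |v|) j≤ ,
    trans (cong (λ f → Ψ f ⊝ Ψ (pref u n)) (sym factor≡)) (relParikh-prefixDiff u n B j j≤)
    where
    j≤ : j ≤ B ∸ n
    j≤ = m+n≤o⇒m≤o∸n j j+n≤B
  from : PrefixDiffs _ _ x → InPrel u n x
  from (j , j≤ , refl) = j , sym (relParikh-prefixDiff u n B j (subst (j ≤_) |v| j≤))

-- Proposition 3.8.  Recurrence and the border condition on u_[B] are part of
-- the paper's setting; the equality itself only needs that u_[B] contains
-- every factor of length n.
proposition3p8 : ∀ {m : ℕ} (u : InfWord m) (n B : ℕ) →
    Recurrent u → B ≥ n →
    (∀ i → ∃[ j ] (j + n ≤ B × factor u j n ≡ factor u i n)) →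
    take n (pref u B) ≡ pref u n →
    drop (B ∸ n) (pref u B) ≡ pref u n →
    (Z : CoDecomposition (take (B ∸ n) (pref u B)) (drop n (pref u B))) →
    ∀ (x : Vec ℤ m) → InPrel u n x ⇔ InUnion (CoDecomposition.pairs Z) x
proposition3p8 u n B _ _ covers _ _ Z x =
  ⇔.trans (relParikh⇔prefixDiffs u n B covers x) (⇔.sym (coDecomposition-union Z x))
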